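{- Let $D_\circ$ be a hollow dissection and $D_\bullet$ a maximal $D_\circ$-accordion dissection. Then: (i) for every $\delta_\bullet\in D_\bullet$, all coordinates of $\mathbf{c}(D_\circ\mid D_\bullet\mid\delta_\bullet)$ are $\ge 0$, or all are $\le 0$; (ii) for every $\delta_\circ\in D_\circ$, the $\delta_\circ$-coordinates of the vectors $\mathbf{g}(D_\circ\mid\delta_\bullet)$, $\delta_\bullet\in D_\bullet$, are all $\ge 0$ or all $\le 0$.
   Context: Fix $n\ge 2$ and $2n$ points on the unit circle of the (standardly oriented) Euclidean plane, labeled $1,\dots,2n$ clockwise. Odd points are hollow, even points solid; the hollow (resp. solid) polygon is their convex hull. A hollow (resp. solid) diagonal joins two hollow (resp. solid) points; polygon edges (boundary edges) count as diagonals, others are internal. Segments cross if they meet at a point interior to both. A hollow (resp. solid) dissection is a set of pairwise non-crossing internal hollow (resp. solid) diagonals; cells are closures of connected components of the polygon minus its diagonals; $\overline{D}$ is $D$ plus all boundary edges. For a hollow dissection $D_\circ$, a solid diagonal is a $D_\circ$-accordion diagonal if the union of the segments of $\overline{D_\circ}$ it crosses is connected; a $D_\circ$-accordion dissection is a solid dissection of such diagonals, maximal if inclusion-maximal. Sign function: for a dissection $R$ of one polygon, $r\in R$ and a diagonal $e$ of the other: $\zeta_R(r,e)=0$ if $e$ does not cross $r$; otherwise in each of the two cells of $R$ containing $r$, $e$ crosses exactly one other segment of $\overline R$, say $\mu,\nu$; if these are incident to distinct endpoints of $r$, write $r=uv,\mu=au,\nu=vb$ and $\zeta_R(r,e)=1$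 if $a$ is strictly right of the directed line $u\to v$, $-1$ if strictly left; otherwise $0$. $\mathbf{g}(D_\circ\mid\delta_\bullet)=\sum_{\delta_\circ\in D_\circ}\zeta_{D_\circ}(\delta_\circ,\delta_\bullet)\mathbf{e}_{\delta_\circ}\in\mathbb{R}^{D_\circ}$; for $\delta_\bullet\in D_\bullet$, $\mathbf{c}(D_\circ\mid D_\bullet\mid\delta_\bullet)=-\sum_{\delta_\circ\in D_\circ}\zeta_{D_\bullet}(\delta_\bullet,\delta_\circ)\mathbf{e}_{\delta_\circ}$. -}

module Defs where

open import Data.Nat using (ℕ; zero; suc; _+_; _*_; _∸_; _<_; _≤_; _<ᵇ_; _≤ᵇ_; _≡ᵇ_)
open import Data.Bool using (Bool; true; false; _∧_; _∨_; not; if_then_else_)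
open import Data.Integer using (ℤ; +_; -_)
open import Data.List using (List; []; _∷_; _++_; map; upTo; [_]) renaming (filterᵇ to filter)
open import Data.Bool.ListAction using (any; all)
open import Data.List.Membership.Propositional using (_∈_)
open import Data.List.Relation.Unary.All using (All)
open import Data.Product using (Σ; _×_; _,_; proj₁; proj₂)
open import Data.Sum using (_⊎_)
open import Relation.Binary.PropositionalEquality using (_≡_)
open import Relation.Nullary using (¬_)

-- The 2n points on the circle are identified with their
-- labels 1,…,2n (clockwise).  Hollow points are the odd labels
-- 1,3,…,2n-1, solid points the even labels 2,4,…,2n.  A segment between
-- two labelled points is a pair (a , b) of labels; every diagonal is
-- stored normalised with a < b.

Seg : Set
Seg = ℕ × ℕ

data Col : Set where
  hol sol : Col

first : Col → ℕ
first hol = 1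
first sol = 2

Pt : ℕ → Col → ℕ → Set
Pt n c x = Σ ℕ λ j → j < n × x ≡ first c + 2 * j

-- diagonals of the colour-c polygon (boundary edges included), normalised a < b
Diag : ℕ → Col → Seg → Set
Diag n c (a , b) = Pt n c a × Pt n c b × a < b

bnd : ℕ → Col → List Seg
bnd n c = map (λ j → (first c + 2 * j , first c + 2 * j + 2)) (upTo (n ∸ 1))
          ++ [ (first c , first c + 2 * (n ∸ 1)) ]

Internal : ℕ → Col → Seg → Set
Internal n c s = Diag n c s × ¬ (s ∈ bnd n c)

Cross : Seg → Seg → Set
Cross (a , b) (c , d) = (a < c × c < b × b < d) ⊎ (c < a × a < d × d < b)

Dissection : ℕ → Col → List Seg → Set
Dissection n c D = All (Internal n c) D × (∀ {s t} → s ∈ D → t ∈ D → ¬ Cross s t)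

InBar : ℕ → Col → List Seg → Seg → Set
InBar n c D s = s ∈ D ⊎ s ∈ bnd n c

-- Chords among the 2n points that
-- pairwise do not cross meet only at common endpoints; hence the union of
-- a family of such chords is connected iff the "share an endpoint" graph
-- on the family is connected.

ShareEnd : Seg → Seg → Set
ShareEnd (a , b) (c , d) = a ≡ c ⊎ a ≡ d ⊎ b ≡ c ⊎ b ≡ d

data Path (P : Seg → Set) : Seg → Seg → Set where
  stop : ∀ {s} → P s → Path P s s
  step : ∀ {s s′ t} → P s → ShareEnd s s′ → Path P s′ t → Path P s t

Connected : (Seg → Set) → Set
Connected P = ∀ {s t} → P s → P t → Path P s t

AccDiag : ℕ → List Seg → Seg → Set
AccDiag n D∘ e = Diag n sol e × Connected (λ s → InBar n hol D∘ s × Cross s e)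

AccDiss : ℕ → List Seg → List Seg → Set
AccDiss n D∘ D = Dissection n sol D × All (AccDiag n D∘) D

MaxAccDiss : ℕ → List Seg → List Seg → Set
MaxAccDiss n D∘ D =
  AccDiss n D∘ D ×
  (∀ D′ → AccDiss n D∘ D′ → (∀ {s} → s ∈ D → s ∈ D′) → ∀ {s} → s ∈ D′ → s ∈ D)

-- The sign function ζ_R(r,e), computed combinatorially.

segEqᵇ : Seg → Seg → Bool
segEqᵇ (a , b) (c , d) = (a ≡ᵇ c) ∧ (b ≡ᵇ d)

crossᵇ : Seg → Seg → Bool
crossᵇ (a , b) (c , d) =
  ((a <ᵇ c) ∧ (c <ᵇ b) ∧ (b <ᵇ d)) ∨ ((c <ᵇ a) ∧ (a <ᵇ d) ∧ (d <ᵇ b))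

-- s lies in the closed side of the chord t = (a,b) containing the arc a..b
inSideᵇ : Seg → Seg → Bool
inSideᵇ (a , b) (x , y) = (a ≤ᵇ x) ∧ (x ≤ᵇ b) ∧ (a ≤ᵇ y) ∧ (y ≤ᵇ b)

-- s lies in the other closed side of t = (a,b)
outSideᵇ : Seg → Seg → Bool
outSideᵇ (a , b) (x , y) = ((x ≤ᵇ a) ∨ (b ≤ᵇ x)) ∧ ((y ≤ᵇ a) ∨ (b ≤ᵇ y))

-- t separates r from s (r, s, t segments of a non-crossing family)
separatesᵇ : Seg → Seg → Seg → Bool
separatesᵇ t r s =
  not (segEqᵇ t s) ∧ not (segEqᵇ t r) ∧
  ((inSideᵇ t r ∧ outSideᵇ t s) ∨ (outSideᵇ t r ∧ inSideᵇ t s))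

-- the segments of R̄ (other than r) bounding the cell of R that contains r
-- and lies on the given closed side of r: those on that side not separated
-- from r by any segment of R̄
cellSides : (Seg → Seg → Bool) → List Seg → Seg → List Seg
cellSides side Rbar r =
  filter (λ s → not (segEqᵇ s r) ∧ side r s ∧
                not (any (λ t → separatesᵇ t r s) Rbar)) Rbar

data Unique? : Set where
  none : Unique?
  just : Seg → Unique?

theOne : List Seg → Unique?
theOne []      = none
theOne (s ∷ l) = if all (segEqᵇ s) l then just s else none

cwOpenᵇ : ℕ → ℕ → ℕ → Bool
cwOpenᵇ x y a = if x <ᵇ y then (x <ᵇ a) ∧ (a <ᵇ y) else ((x <ᵇ a) ∨ (a <ᵇ y))

-- a is strictly to the right of the directed line u → v (standard
-- orientation, points labelled clockwise on the circle)
rightOfᵇ : ℕ → ℕ → ℕ → Bool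
rightOfᵇ u v a = cwOpenᵇ v u a

signOf : ℕ → ℕ → ℕ → ℤ
signOf u v a =
  if rightOfᵇ u v a then + 1 else (if rightOfᵇ v u a then - (+ 1) else + 0)

incᵇ : ℕ → Seg → Bool
incᵇ x (p , q) = (x ≡ᵇ p) ∨ (x ≡ᵇ q)

otherEnd : ℕ → Seg → ℕ
otherEnd x (p , q) = if x ≡ᵇ p then q else p

zetaCore : Seg → Seg → Seg → ℤ
zetaCore (u , v) μ ν =
  if incᵇ u μ ∧ incᵇ v ν then signOf u v (otherEnd u μ)
  else (if incᵇ v μ ∧ incᵇ u ν then signOf v u (otherEnd v μ) else + 0)

-- ζ_R(r,e) for a dissection R of the colour-c polygon, r ∈ R, e a diagonal
-- of the other polygon
zeta : ℕ → Col → List Seg → Seg → Seg → ℤ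
zeta n c R r e with crossᵇ r e
... | false = + 0
... | true with theOne (filter (crossᵇ e) (cellSides inSideᵇ (R ++ bnd n c) r))
             | theOne (filter (crossᵇ e) (cellSides outSideᵇ (R ++ bnd n c) r))
...   | just μ | just ν = zetaCore r μ ν
...   | _      | _      = + 0

-- δ∘-coordinate of g(D∘ | δ•)
gvec : ℕ → List Seg → Seg → Seg → ℤ
gvec n D∘ δ• δ∘ = zeta n hol D∘ δ∘ δ•

-- δ∘-coordinate of c(D∘ | D• | δ•)
cvec : ℕ → List Seg → List Seg → Seg → Seg → ℤ
cvec n D∘ D• δ• δ∘ = - zeta n sol D• δ• δ∘

{-# OPTIONS --safe #-}
-- Let e cross the diagonal r = (u , v), u < v, of a dissection R.  If ζ_R(r , e) = -1,
-- then in the two cells at r, e crosses a segment (u , q) of R̄ and a segment joining v to a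
-- point b beyond the arc u..v; if ζ_R(r , e) = +1, it crosses (p , v) and a segment joining
-- u to such a b.  Take e₁ of the first kind and e₂ of the second.  As (u , q) and (p , v)
-- do not cross, q ≤ p, so the end of e₁ inside the arc comes before that of e₂.  As the two
-- outer segments do not cross, reading clockwise from u their far ends b₁, b₂ and the outer
-- ends o₁, o₂ of e₁, e₂ come in the order o₁, b₁, b₂, o₂.  So the ends of e₁ and e₂
-- interleave and e₁ crosses e₂.  Hence the diagonals of a dissection of the other polygon
-- never take both signs at r: this is (i) for R = D• and (ii) for R = D∘.
module Submission where

open import Defs
open import Data.Nat using (ℕ; _≤_)
open import Data.Integer using (ℤ) renaming (_≤_ to _≤ℤ_; 0ℤ to 0ℤ)
open import Data.List using (List)
open import Data.List.Membership.Propositional using (_∈_)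
open import Data.Product using (_×_)
open import Data.Sum using (_⊎_)

open import Data.Nat using (suc; _+_; _*_; _<_; _<ᵇ_; _≤ᵇ_; _≡ᵇ_; z≤n; s≤s; z<s; s≤s⁻¹)
open import Data.Nat.Properties
open import Data.Nat.Tactic.RingSolver using (solve-∀)
open import Data.Integer using (-_; -1ℤ; 1ℤ; +≤+; -≤+)
import Data.Integer.Properties as ℤ
open import Data.Bool using (Bool; true; false; T; not; _∧_; _∨_)
open import Data.Bool.Properties using (T-∧; T-∨; T-≡; T-not-≡; ¬-not)
open import Data.Bool.ListAction using (all; any)
open import Data.Empty using (⊥; ⊥-elim)
open import Data.List using ([]; _∷_; _++_; map; upTo; filterᵇ)
open import Data.List.Relation.Unary.Any using (here; any?)
import Data.List.Relation.Unary.All as All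
open import Data.List.Membership.Propositional using (lose; find)
open import Data.List.Membership.Propositional.Properties
  using (∈-map⁻; ∈-++⁻; ∈-filter⁻; ∈-upTo⁻)
open import Data.Product using (∃; ∃₂; _,_; proj₁; proj₂)
open import Data.Sum using (inj₁; inj₂; [_,_]′; swap)
import Data.Sum as Sum
open import Function using (_∘_)
open import Function.Bundles using (Equivalence)
open import Relation.Binary.PropositionalEquality
  using (_≡_; _≢_; refl; sym; trans; cong; subst)
open import Relation.Binary.Definitions using (tri<; tri≈; tri>)
open import Relation.Nullary using (¬_; yes; no; contradiction)
open import Relation.Nullary.Decidable using (T?)

open Equivalence using (to; from)

Incident : ℕ → Seg → Set
Incident x (a , b) = x ≡ a ⊎ x ≡ b

Ordered : List Seg → Set
Ordered S = ∀ {s} → s ∈ S → proj₁ s < proj₂ s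

NonCrossing : List Seg → Set
NonCrossing S = ∀ {s t} → s ∈ S → t ∈ S → ¬ Cross s t

cross-sym : ∀ {s t} → Cross s t → Cross t s
cross-sym {_ , _} {_ , _} = swap

crossing-end-inside : ∀ {a b c d} → Cross (a , b) (c , d) → (a < c × c < b) ⊎ (a < d × d < b)
crossing-end-inside (inj₁ (a<c , c<b , _)) = inj₁ (a<c , c<b)
crossing-end-inside (inj₂ (_ , a<d , d<b)) = inj₂ (a<d , d<b)

crossing-end-outside : ∀ {a b c d} → Cross (a , b) (c , d) → c < a ⊎ b < d
crossing-end-outside (inj₁ (_ , _ , b<d)) = inj₂ b<d
crossing-end-outside (inj₂ (c<a , _ , _)) = inj₁ c<a

next-vertex-label : ∀ a j → a + 2 * j + 2 ≡ a + 2 * suc j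
next-vertex-label = solve-∀

Pt-gap : ∀ {n c x} j → Pt n c x → first c + 2 * j < x → x < first c + 2 * j + 2 → ⊥
Pt-gap {c = c} j (k , _ , refl) lo hi = <⇒≱ j<k (s≤s⁻¹ k<1+j)
  where
  j<k = *-cancelˡ-< 2 j k (+-cancelˡ-< (first c) (2 * j) (2 * k) lo)
  k<1+j = *-cancelˡ-< 2 k (suc j) (+-cancelˡ-< (first c) (2 * k) (2 * suc j)
            (subst (first c + 2 * k <_) (next-vertex-label (first c) j) hi))

Pt-bounds : ∀ {m c x} → Pt (suc m) c x → first c ≤ x × x ≤ first c + 2 * m
Pt-bounds {c = c} (k , s≤s k≤m , refl) =
  m≤m+n (first c) (2 * k) , +-monoʳ-≤ (first c) (*-monoʳ-≤ 2 k≤m)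

∈-bnd⁻ : ∀ {m c s} → s ∈ bnd (suc m) c →
    (∃ λ j → j < m × s ≡ (first c + 2 * j , first c + 2 * j + 2))
  ⊎ s ≡ (first c , first c + 2 * m)
∈-bnd⁻ {m} {c} s∈ with ∈-++⁻ (map (λ j → (first c + 2 * j , first c + 2 * j + 2)) (upTo m)) s∈
... | inj₁ s∈edges = let j , j∈ , s≡ = ∈-map⁻ _ s∈edges in inj₁ (j , ∈-upTo⁻ j∈ , s≡)
... | inj₂ (here s≡) = inj₂ s≡

bnd-Diag : ∀ {m c s} → 0 < m → s ∈ bnd (suc m) c → Diag (suc m) c s
bnd-Diag {m} {c} 0<m s∈ with ∈-bnd⁻ {m} {c} s∈
... | inj₁ (j , j<m , refl) =
  (j , m<n⇒m<1+n j<m , refl) , (suc j , s≤s j<m , next-vertex-label (first c) j) ,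
  m<m+n (first c + 2 * j) z<s
... | inj₂ refl =
  (0 , z<s , sym (+-identityʳ (first c))) , (m , n<1+n m , refl) ,
  m<m+n (first c) (<-≤-trans 0<m (m≤m+n m _))

-- A chord crossing a side has an end strictly inside the side's arc and one strictly outside
-- it; there is no vertex of the first kind for the sides (F + 2j , F + 2j + 2), and none of
-- the second kind for the closing side (F , F + 2m).
bnd-noncrossing : ∀ {m c s t} → s ∈ bnd (suc m) c → Diag (suc m) c t → ¬ Cross s t
bnd-noncrossing {m} {c} {t = a , b} s∈ (a-Pt , b-Pt , _) s×t with ∈-bnd⁻ {m} {c} s∈
... | inj₁ (j , _ , refl) =
  [ (λ (lo , hi) → Pt-gap {c = c} j a-Pt lo hi) , (λ (lo , hi) → Pt-gap {c = c} j b-Pt lo hi) ]′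
    (crossing-end-inside s×t)
... | inj₂ refl =
  [ (λ a<F → <⇒≱ a<F (proj₁ (Pt-bounds {c = c} a-Pt)))
  , (λ L<b → <⇒≱ L<b (proj₂ (Pt-bounds {c = c} b-Pt)))  ]′
    (crossing-end-outside s×t)

barred-Diag : ∀ {m c R} → 0 < m → Dissection (suc m) c R →
  ∀ {s} → s ∈ R ++ bnd (suc m) c → Diag (suc m) c s
barred-Diag {R = R} 0<m (internal , _) s∈ with ∈-++⁻ R s∈
... | inj₁ s∈R   = proj₁ (All.lookup internal s∈R)
... | inj₂ s∈bnd = bnd-Diag 0<m s∈bnd

barred-ordered : ∀ {m c R} → 0 < m → Dissection (suc m) c R → Ordered (R ++ bnd (suc m) c)
barred-ordered 0<m dissection s∈ = proj₂ (proj₂ (barred-Diag 0<m dissection s∈))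

barred-noncrossing : ∀ {m c R} → 0 < m → Dissection (suc m) c R →
  NonCrossing (R ++ bnd (suc m) c)
barred-noncrossing {R = R} 0<m dissection s∈ t∈ with ∈-++⁻ R s∈ | ∈-++⁻ R t∈
... | inj₁ s∈R   | inj₁ t∈R   = proj₂ dissection s∈R t∈R
... | inj₂ s∈bnd | _          = bnd-noncrossing s∈bnd (barred-Diag 0<m dissection t∈)
... | inj₁ _     | inj₂ t∈bnd = bnd-noncrossing t∈bnd (barred-Diag 0<m dissection s∈) ∘ cross-sym

data JoinsOutside (u v x : ℕ) : ℕ → Seg → Set where
  above : ∀ {y} → v < y → JoinsOutside u v x y (x , y)
  below : ∀ {y} → y < u → JoinsOutside u v x y (y , x)

-- x comes before y when the labels are read clockwise starting from u.
data _≺[_]_ (x u : ℕ) : ℕ → Set where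
  upper : ∀ {y} → u ≤ x → x < y → x ≺[ u ] y
  wrap  : ∀ {y} → u ≤ x → y < u → x ≺[ u ] y
  lower : ∀ {y} → x < y → y < u → x ≺[ u ] y

≺-trans : ∀ {u x y z} → x ≺[ u ] y → y ≺[ u ] z → x ≺[ u ] z
≺-trans (upper u≤x x<y) (upper _ y<z)   = upper u≤x (<-trans x<y y<z)
≺-trans (upper u≤x _)   (wrap _ z<u)    = wrap u≤x z<u
≺-trans (upper u≤x x<y) (lower y<z z<u) = ⊥-elim (<⇒≱ (<-trans y<z z<u) (≤-trans u≤x (<⇒≤ x<y)))
≺-trans (wrap _ y<u)    (upper u≤y _)   = ⊥-elim (<⇒≱ y<u u≤y)
≺-trans (wrap _ y<u)    (wrap u≤y _)    = ⊥-elim (<⇒≱ y<u u≤y)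
≺-trans (wrap u≤x _)    (lower _ z<u)   = wrap u≤x z<u
≺-trans (lower _ y<u)   (upper u≤y _)   = ⊥-elim (<⇒≱ y<u u≤y)
≺-trans (lower _ y<u)   (wrap u≤y _)    = ⊥-elim (<⇒≱ y<u u≤y)
≺-trans (lower x<y _)   (lower y<z z<u) = lower (<-trans x<y y<z) z<u

crossing-ends : ∀ {u v e} → Cross (u , v) e → ∃₂ λ i o → u < i × i < v × JoinsOutside u v i o e
crossing-ends {e = x , y} (inj₁ (u<x , x<v , v<y)) = x , y , u<x , x<v , above v<y
crossing-ends {e = x , y} (inj₂ (x<u , u<y , y<v)) = y , x , u<y , y<v , below x<u

inner-end-before : ∀ {u v i o q e} → u < i → JoinsOutside u v i o e → Cross e (u , q) → i < q
inner-end-before u<i (above _)   (inj₁ (i<u , _ , _))   = ⊥-elim (<-asym u<i i<u)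
inner-end-before u<i (above _)   (inj₂ (_ , i<q , _))   = i<q
inner-end-before u<i (below _)   (inj₁ (_ , _ , i<q))   = i<q
inner-end-before u<i (below o<u) (inj₂ (u<o , _ , _))   = ⊥-elim (<-asym o<u u<o)

inner-end-after : ∀ {u v i o p e} → i < v → JoinsOutside u v i o e → Cross e (p , v) → p < i
inner-end-after i<v (above v<o) (inj₁ (_ , _ , o<v)) = ⊥-elim (<-asym v<o o<v)
inner-end-after i<v (above _)   (inj₂ (p<i , _ , _)) = p<i
inner-end-after i<v (below _)   (inj₁ (_ , p<i , _)) = p<i
inner-end-after i<v (below _)   (inj₂ (_ , _ , v<i)) = ⊥-elim (<-asym i<v v<i)

outer-segment-at-v : ∀ {u v c d} → c < d → (c ≤ u ⊎ v ≤ c) → (c , d) ≢ (u , v) →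
  Incident v (c , d) → ∃ λ b → JoinsOutside u v v b (c , d)
outer-segment-at-v c<d _ _ (inj₁ refl) = _ , above c<d
outer-segment-at-v c<d (inj₁ c≤u) ν≢r (inj₂ refl) = _ , below (≤∧≢⇒< c≤u (ν≢r ∘ cong (_, _)))
outer-segment-at-v c<d (inj₂ d≤c) _ (inj₂ refl) = ⊥-elim (<⇒≱ c<d d≤c)

outer-segment-at-u : ∀ {u v c d} → c < d → (d ≤ u ⊎ v ≤ d) → (c , d) ≢ (u , v) →
  Incident u (c , d) → ∃ λ b → JoinsOutside u v u b (c , d)
outer-segment-at-u c<d (inj₁ d≤c) _ (inj₁ refl) = ⊥-elim (<⇒≱ c<d d≤c)
outer-segment-at-u c<d (inj₂ v≤d) ν≢r (inj₁ refl) = _ , above (≤∧≢⇒< v≤d (ν≢r ∘ cong (_ ,_) ∘ sym))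
outer-segment-at-u c<d _ _ (inj₂ refl) = _ , below c<d

exit-beyond-v : ∀ {u v i o b e ν} → u < i → i < v → JoinsOutside u v i o e →
  JoinsOutside u v v b ν → Cross e ν → o ≺[ u ] b
exit-beyond-v u<i i<v (above _) (above _) (inj₁ (_ , v<o , o<b)) =
  upper (<⇒≤ (<-trans u<i (<-trans i<v v<o))) o<b
exit-beyond-v u<i i<v (above _) (above _) (inj₂ (v<i , _ , _)) = ⊥-elim (<-asym i<v v<i)
exit-beyond-v u<i i<v (above _) (below b<u) (inj₁ (i<b , _ , _)) =
  ⊥-elim (<-asym u<i (<-trans i<b b<u))
exit-beyond-v u<i i<v (above v<o) (below b<u) (inj₂ _) =
  wrap (<⇒≤ (<-trans u<i (<-trans i<v v<o))) b<u
exit-beyond-v u<i i<v (below _) (above _) (inj₁ (_ , v<i , _)) = ⊥-elim (<-asym i<v v<i)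
exit-beyond-v u<i i<v (below o<u) (above _) (inj₂ (v<o , _ , _)) =
  ⊥-elim (<-asym o<u (<-trans u<i (<-trans i<v v<o)))
exit-beyond-v u<i i<v (below _) (below b<u) (inj₁ (o<b , _ , _)) = lower o<b b<u
exit-beyond-v u<i i<v (below _) (below _) (inj₂ (_ , _ , v<i)) = ⊥-elim (<-asym i<v v<i)

exit-beyond-u : ∀ {u v i o b e ν} → u < i → i < v → JoinsOutside u v i o e →
  JoinsOutside u v u b ν → Cross e ν → b ≺[ u ] o
exit-beyond-u u<i i<v (above _) (above _) (inj₁ (i<u , _ , _)) = ⊥-elim (<-asym u<i i<u)
exit-beyond-u u<i i<v (above _) (above v<b) (inj₂ (_ , _ , b<o)) =
  upper (<⇒≤ (<-trans (<-trans u<i i<v) v<b)) b<o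
exit-beyond-u u<i i<v (above _) (below b<u) (inj₁ (i<b , _ , _)) =
  ⊥-elim (<-asym u<i (<-trans i<b b<u))
exit-beyond-u u<i i<v (above _) (below _) (inj₂ (_ , i<u , _)) = ⊥-elim (<-asym u<i i<u)
exit-beyond-u u<i i<v (below o<u) (above v<b) (inj₁ _) =
  wrap (<⇒≤ (<-trans (<-trans u<i i<v) v<b)) o<u
exit-beyond-u u<i i<v (below o<u) (above _) (inj₂ (u<o , _ , _)) = ⊥-elim (<-asym o<u u<o)
exit-beyond-u u<i i<v (below _) (below _) (inj₁ (_ , _ , i<u)) = ⊥-elim (<-asym u<i i<u)
exit-beyond-u u<i i<v (below o<u) (below _) (inj₂ (b<o , _ , _)) = lower b<o o<u

record NegativeCrossing (Rb : List Seg) (u v : ℕ) (e : Seg) : Set where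
  field
    q i o b : ℕ
    inner   : (u , q) ∈ Rb
    u<i     : u < i
    i<q     : i < q
    q<v     : q < v
    e-joins : JoinsOutside u v i o e
    ν       : Seg
    outer   : ν ∈ Rb
    ν-joins : JoinsOutside u v v b ν
    o≺b     : o ≺[ u ] b

record PositiveCrossing (Rb : List Seg) (u v : ℕ) (e : Seg) : Set where
  field
    p i o b : ℕ
    inner   : (p , v) ∈ Rb
    u<p     : u < p
    p<i     : p < i
    i<v     : i < v
    e-joins : JoinsOutside u v i o e
    ν       : Seg
    outer   : ν ∈ Rb
    ν-joins : JoinsOutside u v u b ν
    b≺o     : b ≺[ u ] o

interleaved-ends-cross : ∀ {u v i₁ i₂ o₁ o₂ e₁ e₂} → u < i₁ → i₁ < i₂ → i₂ < v →
  JoinsOutside u v i₁ o₁ e₁ → JoinsOutside u v i₂ o₂ e₂ → o₁ ≺[ u ] o₂ → Cross e₁ e₂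
interleaved-ends-cross u<i₁ i₁<i₂ i₂<v (above v<o₁) (above _) (upper _ o₁<o₂) =
  inj₁ (i₁<i₂ , <-trans i₂<v v<o₁ , o₁<o₂)
interleaved-ends-cross u<i₁ i₁<i₂ i₂<v (above _) (below o₂<u) (upper u≤o₁ o₁<o₂) =
  ⊥-elim (<⇒≱ o₂<u (≤-trans u≤o₁ (<⇒≤ o₁<o₂)))
interleaved-ends-cross u<i₁ i₁<i₂ i₂<v (below o₁<u) _ (upper u≤o₁ _) = ⊥-elim (<⇒≱ o₁<u u≤o₁)
interleaved-ends-cross u<i₁ i₁<i₂ i₂<v (above _) (above v<o₂) (wrap _ o₂<u) =
  ⊥-elim (<-asym o₂<u (<-trans (<-trans u<i₁ (<-trans i₁<i₂ i₂<v)) v<o₂))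
interleaved-ends-cross u<i₁ i₁<i₂ i₂<v (above v<o₁) (below _) (wrap _ o₂<u) =
  inj₂ (<-trans o₂<u u<i₁ , i₁<i₂ , <-trans i₂<v v<o₁)
interleaved-ends-cross u<i₁ i₁<i₂ i₂<v (below o₁<u) _ (wrap u≤o₁ _) = ⊥-elim (<⇒≱ o₁<u u≤o₁)
interleaved-ends-cross u<i₁ i₁<i₂ i₂<v (above v<o₁) _ (lower o₁<o₂ o₂<u) =
  ⊥-elim (<-asym (<-trans o₁<o₂ o₂<u) (<-trans u<i₁ (<-trans (<-trans i₁<i₂ i₂<v) v<o₁)))
interleaved-ends-cross u<i₁ i₁<i₂ i₂<v (below _) (above v<o₂) (lower _ o₂<u) =
  ⊥-elim (<-asym o₂<u (<-trans (<-trans u<i₁ (<-trans i₁<i₂ i₂<v)) v<o₂))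
interleaved-ends-cross u<i₁ i₁<i₂ i₂<v (below _) (below _) (lower o₁<o₂ o₂<u) =
  inj₁ (o₁<o₂ , <-trans o₂<u u<i₁ , i₁<i₂)

outer-ends-ordered : ∀ {u v b₁ b₂ ν₁ ν₂} → u < v →
  JoinsOutside u v v b₁ ν₁ → JoinsOutside u v u b₂ ν₂ → ¬ Cross ν₁ ν₂ → ¬ Cross ν₂ ν₁ →
  b₁ ≡ b₂ ⊎ b₁ ≺[ u ] b₂
outer-ends-ordered {b₁ = b₁} {b₂} u<v (above v<b₁) (above v<b₂) _ ν₂⋈ν₁ with <-cmp b₁ b₂
... | tri< b₁<b₂ _ _ = inj₂ (upper (<⇒≤ (<-trans u<v v<b₁)) b₁<b₂)
... | tri≈ _ b₁≡b₂ _ = inj₁ b₁≡b₂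
... | tri> _ _ b₂<b₁ = ⊥-elim (ν₂⋈ν₁ (inj₁ (u<v , v<b₂ , b₂<b₁)))
outer-ends-ordered u<v (above v<b₁) (below b₂<u) _ _ = inj₂ (wrap (<⇒≤ (<-trans u<v v<b₁)) b₂<u)
outer-ends-ordered u<v (below b₁<u) (above v<b₂) ν₁⋈ν₂ _ = ⊥-elim (ν₁⋈ν₂ (inj₁ (b₁<u , u<v , v<b₂)))
outer-ends-ordered {b₁ = b₁} {b₂} u<v (below b₁<u) (below b₂<u) _ ν₂⋈ν₁ with <-cmp b₁ b₂
... | tri< b₁<b₂ _ _ = inj₂ (lower b₁<b₂ b₂<u)
... | tri≈ _ b₁≡b₂ _ = inj₁ b₁≡b₂
... | tri> _ _ b₂<b₁ = ⊥-elim (ν₂⋈ν₁ (inj₁ (b₂<b₁ , b₁<u , u<v)))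

opposite-crossings-cross : ∀ {Rb u v e₁ e₂} → NonCrossing Rb →
  NegativeCrossing Rb u v e₁ → PositiveCrossing Rb u v e₂ → Cross e₁ e₂
opposite-crossings-cross nc N P =
  interleaved-ends-cross N.u<i i₁<i₂ P.i<v N.e-joins P.e-joins o₁≺o₂
  where
  module N = NegativeCrossing N
  module P = PositiveCrossing P
  u<v = <-trans P.u<p (<-trans P.p<i P.i<v)
  q≤p : N.q ≤ P.p
  q≤p = ≮⇒≥ λ p<q → nc N.inner P.inner (inj₁ (P.u<p , p<q , N.q<v))
  i₁<i₂ : N.i < P.i
  i₁<i₂ = <-trans (<-≤-trans N.i<q q≤p) P.p<i
  o₁≺o₂ : N.o ≺[ _ ] P.o
  o₁≺o₂ with outer-ends-ordered u<v N.ν-joins P.ν-joins (nc N.outer P.outer) (nc P.outer N.outer)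
  ... | inj₁ refl   = ≺-trans N.o≺b P.b≺o
  ... | inj₂ b₁≺b₂ = ≺-trans N.o≺b (≺-trans b₁≺b₂ P.b≺o)

<ᵇ-true : ∀ {m n} → m < n → (m <ᵇ n) ≡ true
<ᵇ-true = to T-≡ ∘ <⇒<ᵇ

<ᵇ-false : ∀ {m n} → n ≤ m → (m <ᵇ n) ≡ false
<ᵇ-false {m} {n} n≤m = ¬-not λ m<ᵇn → <⇒≱ (<ᵇ⇒< m n (from T-≡ m<ᵇn)) n≤m

≡ᵇ-true : ∀ m → (m ≡ᵇ m) ≡ true
≡ᵇ-true m = to T-≡ (≡⇒≡ᵇ m m refl)

≡ᵇ-false : ∀ {m n} → m ≢ n → (m ≡ᵇ n) ≡ false
≡ᵇ-false {m} {n} m≢n = ¬-not λ m≡ᵇn → m≢n (≡ᵇ⇒≡ m n (from T-≡ m≡ᵇn))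

<ᵇ-chain : ∀ a b c d → T ((a <ᵇ b) ∧ (b <ᵇ c) ∧ (c <ᵇ d)) → a < b × b < c × c < d
<ᵇ-chain a b c d h =
  let a<b , h′ = to (T-∧ {a <ᵇ b}) h
      b<c , c<d = to (T-∧ {b <ᵇ c}) h′
  in <ᵇ⇒< a b a<b , <ᵇ⇒< b c b<c , <ᵇ⇒< c d c<d

crossᵇ-sound : ∀ s t → T (crossᵇ s t) → Cross s t
crossᵇ-sound (a , b) (c , d) =
  Sum.map (<ᵇ-chain a c b d) (<ᵇ-chain c a d b) ∘ to (T-∨ {(a <ᵇ c) ∧ (c <ᵇ b) ∧ (b <ᵇ d)})

inSideᵇ-sound : ∀ {a b x y} → T (inSideᵇ (a , b) (x , y)) → a ≤ x × y ≤ b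
inSideᵇ-sound {a} {b} {x} {y} h =
  let a≤x , h₁ = to (T-∧ {a ≤ᵇ x}) h
      _ , h₂ = to (T-∧ {x ≤ᵇ b}) h₁
      _ , y≤b = to (T-∧ {a ≤ᵇ y}) h₂
  in ≤ᵇ⇒≤ a x a≤x , ≤ᵇ⇒≤ y b y≤b

outSideᵇ-sound : ∀ {a b x y} → T (outSideᵇ (a , b) (x , y)) →
  (x ≤ a ⊎ b ≤ x) × (y ≤ a ⊎ b ≤ y)
outSideᵇ-sound {a} {b} {x} {y} h =
  let hx , hy = to (T-∧ {(x ≤ᵇ a) ∨ (b ≤ᵇ x)}) h
  in beyond x hx , beyond y hy
  where
  beyond : ∀ z → T ((z ≤ᵇ a) ∨ (b ≤ᵇ z)) → z ≤ a ⊎ b ≤ z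
  beyond z = Sum.map (≤ᵇ⇒≤ z a) (≤ᵇ⇒≤ b z) ∘ to (T-∨ {z ≤ᵇ a})

incᵇ-sound : ∀ x s → T (incᵇ x s) → Incident x s
incᵇ-sound x (a , b) = Sum.map (≡ᵇ⇒≡ x a) (≡ᵇ⇒≡ x b) ∘ to (T-∨ {x ≡ᵇ a})

segEqᵇ-distinct : ∀ s t → T (not (segEqᵇ s t)) → s ≢ t
segEqᵇ-distinct (a , b) _ s≠t refl =
  subst T (to T-not-≡ s≠t) (from T-∧ (≡⇒≡ᵇ a a refl , ≡⇒≡ᵇ b b refl))

arc-inner : ∀ {x a y} → x < a → a < y → cwOpenᵇ x y a ≡ true
arc-inner x<a a<y rewrite <ᵇ-true (<-trans x<a a<y) | <ᵇ-true x<a | <ᵇ-true a<y = refl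

arc-outer : ∀ {x a y} → x < a → a < y → cwOpenᵇ y x a ≡ false
arc-outer x<a a<y
  rewrite <ᵇ-false (<⇒≤ (<-trans x<a a<y)) | <ᵇ-false (<⇒≤ a<y) | <ᵇ-false (<⇒≤ x<a) = refl

signOf-forward : ∀ {u q v} → u < q → q < v → signOf u v q ≡ -1ℤ
signOf-forward u<q q<v rewrite arc-outer u<q q<v | arc-inner u<q q<v = refl

signOf-backward : ∀ {u p v} → u < p → p < v → signOf v u p ≡ 1ℤ
signOf-backward u<p p<v rewrite arc-inner u<p p<v = refl

otherEnd-left : ∀ u q → otherEnd u (u , q) ≡ q
otherEnd-left u q rewrite ≡ᵇ-true u = refl

otherEnd-right : ∀ {p v} → p < v → otherEnd v (p , v) ≡ p
otherEnd-right p<v rewrite ≡ᵇ-false (>⇒≢ p<v) = refl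

zetaCore-cases : ∀ {u v p q} ν → p < q → u ≤ p → q ≤ v → (p , q) ≢ (u , v) →
    (zetaCore (u , v) (p , q) ν ≡ -1ℤ × p ≡ u × q < v × Incident v ν)
  ⊎ (zetaCore (u , v) (p , q) ν ≡ 1ℤ × q ≡ v × u < p × Incident u ν)
  ⊎ zetaCore (u , v) (p , q) ν ≡ 0ℤ
zetaCore-cases {u} {v} {p} {q} (c , d) p<q u≤p q≤v μ≢r
  with incᵇ u (p , q) ∧ incᵇ v (c , d) in at-u
... | true with to (T-∧ {incᵇ u (p , q)}) (from T-≡ at-u)
...   | u∈μ , v∈ν with incᵇ-sound u (p , q) u∈μ
...     | inj₂ refl = ⊥-elim (<⇒≱ p<q u≤p)
...     | inj₁ refl =
  inj₁ (trans (cong (signOf u v) (otherEnd-left u q)) (signOf-forward p<q q<v) ,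
        refl , q<v , incᵇ-sound v (c , d) v∈ν)
  where q<v = ≤∧≢⇒< q≤v (μ≢r ∘ cong (u ,_))
zetaCore-cases {u} {v} {p} {q} (c , d) p<q u≤p q≤v μ≢r | false
  with incᵇ v (p , q) ∧ incᵇ u (c , d) in at-v
... | false = inj₂ (inj₂ refl)
... | true with to (T-∧ {incᵇ v (p , q)}) (from T-≡ at-v)
...   | v∈μ , u∈ν with incᵇ-sound v (p , q) v∈μ
...     | inj₁ refl = ⊥-elim (<⇒≱ p<q q≤v)
...     | inj₂ refl =
  inj₂ (inj₁ (trans (cong (signOf v u) (otherEnd-right p<q)) (signOf-backward u<p p<q) ,
              refl , u<p , incᵇ-sound u (c , d) u∈ν))
  where u<p = ≤∧≢⇒< u≤p (μ≢r ∘ cong (_, v) ∘ sym)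

theOne-∈ : ∀ {l μ} → theOne l ≡ just μ → μ ∈ l
theOne-∈ {[]} ()
theOne-∈ {s ∷ l} eq with all (segEqᵇ s) l | eq
... | true  | refl = here refl
... | false | ()

CellExit : (Seg → Seg → Bool) → List Seg → Seg → Seg → Seg → Set
CellExit side Rb r e μ = μ ∈ Rb × μ ≢ r × T (side r μ) × Cross e μ

cell-exit : ∀ side Rb r e {μ} →
  theOne (filterᵇ (crossᵇ e) (cellSides side Rb r)) ≡ just μ → CellExit side Rb r e μ
cell-exit side Rb r e {μ} unique
  with ∈-filter⁻ (T? ∘ crossᵇ e) {xs = cellSides side Rb r} (theOne-∈ unique)
... | μ∈cell , e×μ
  with ∈-filter⁻ (T? ∘ λ s → not (segEqᵇ s r) ∧ side r s ∧
                              not (any (λ t → separatesᵇ t r s) Rb)) μ∈cell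
... | μ∈Rb , tests =
  let μ≠r , tests′ = to (T-∧ {not (segEqᵇ μ r)}) tests
  in μ∈Rb , segEqᵇ-distinct μ r μ≠r , proj₁ (to (T-∧ {side r μ}) tests′) ,
     crossᵇ-sound e μ e×μ

record ZetaWitness (Rb : List Seg) (r e : Seg) (z : ℤ) : Set where
  constructor witness
  field
    r×e   : Cross r e
    μ ν   : Seg
    inner : CellExit inSideᵇ Rb r e μ
    outer : CellExit outSideᵇ Rb r e ν
    value : zetaCore r μ ν ≡ z

zeta-witness : ∀ n c R r e → zeta n c R r e ≢ 0ℤ →
  ZetaWitness (R ++ bnd n c) r e (zeta n c R r e)
zeta-witness n c R r e ζ≢0 with crossᵇ r e in r×e
... | false = ⊥-elim (ζ≢0 refl)
... | true with theOne (filterᵇ (crossᵇ e) (cellSides inSideᵇ (R ++ bnd n c) r)) in μ-unique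
             | theOne (filterᵇ (crossᵇ e) (cellSides outSideᵇ (R ++ bnd n c) r)) in ν-unique
...   | none   | _      = ⊥-elim (ζ≢0 refl)
...   | just _ | none   = ⊥-elim (ζ≢0 refl)
...   | just μ | just ν =
  witness (crossᵇ-sound r e (from T-≡ r×e)) μ ν
          (cell-exit inSideᵇ (R ++ bnd n c) r e μ-unique)
          (cell-exit outSideᵇ (R ++ bnd n c) r e ν-unique) refl

witness-sign : ∀ {Rb u v e z} → Ordered Rb → ZetaWitness Rb (u , v) e z →
    (z ≡ -1ℤ × NegativeCrossing Rb u v e)
  ⊎ (z ≡ 1ℤ × PositiveCrossing Rb u v e)
  ⊎ z ≡ 0ℤ
witness-sign ordered
  (witness r×e (p , q) (c , d) (μ∈ , μ≢r , μ-inner , e×μ) (ν∈ , ν≢r , ν-outer , e×ν) value)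
  with inSideᵇ-sound μ-inner | outSideᵇ-sound ν-outer | crossing-ends r×e
... | u≤p , q≤v | c-outer , d-outer | i , o , u<i , i<v , e-joins
  with zetaCore-cases (c , d) (ordered μ∈) u≤p q≤v μ≢r
... | inj₁ (core≡-1 , refl , q<v , v∈ν) =
  let b , ν-joins = outer-segment-at-v (ordered ν∈) c-outer ν≢r v∈ν in
  inj₁ (trans (sym value) core≡-1 , record
    { q = q ; i = i ; o = o ; b = b ; inner = μ∈
    ; u<i = u<i ; i<q = inner-end-before u<i e-joins e×μ ; q<v = q<v ; e-joins = e-joins
    ; ν = c , d ; outer = ν∈ ; ν-joins = ν-joins
    ; o≺b = exit-beyond-v u<i i<v e-joins ν-joins e×ν })
... | inj₂ (inj₁ (core≡1 , refl , u<p , u∈ν)) =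
  let b , ν-joins = outer-segment-at-u (ordered ν∈) d-outer ν≢r u∈ν in
  inj₂ (inj₁ (trans (sym value) core≡1 , record
    { p = p ; i = i ; o = o ; b = b ; inner = μ∈
    ; u<p = u<p ; p<i = inner-end-after i<v e-joins e×μ ; i<v = i<v ; e-joins = e-joins
    ; ν = c , d ; outer = ν∈ ; ν-joins = ν-joins
    ; b≺o = exit-beyond-u u<i i<v e-joins ν-joins e×ν }))
... | inj₂ (inj₂ core≡0) = inj₂ (inj₂ (trans (sym value) core≡0))

zeta-trichotomy : ∀ {n c R} → Ordered (R ++ bnd n c) → ∀ u v e →
    (zeta n c R (u , v) e ≡ -1ℤ × NegativeCrossing (R ++ bnd n c) u v e)
  ⊎ (zeta n c R (u , v) e ≡ 1ℤ × PositiveCrossing (R ++ bnd n c) u v e)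
  ⊎ zeta n c R (u , v) e ≡ 0ℤ
zeta-trichotomy {n} {c} {R} ordered u v e with zeta n c R (u , v) e ℤ.≟ 0ℤ
... | yes ζ≡0 = inj₂ (inj₂ ζ≡0)
... | no ζ≢0  = witness-sign ordered (zeta-witness n c R (u , v) e ζ≢0)

zeta-negative : ∀ {n c R} → Ordered (R ++ bnd n c) → ∀ {u v e} →
  zeta n c R (u , v) e ≡ -1ℤ → NegativeCrossing (R ++ bnd n c) u v e
zeta-negative ordered {u} {v} {e} ζ≡-1 with zeta-trichotomy ordered u v e
... | inj₁ (_ , N)          = N
... | inj₂ (inj₁ (ζ≡1 , _)) = contradiction (trans (sym ζ≡-1) ζ≡1) λ ()
... | inj₂ (inj₂ ζ≡0)       = contradiction (trans (sym ζ≡-1) ζ≡0) λ ()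

zeta-sign-coherent : ∀ {n c R} → Ordered (R ++ bnd n c) → NonCrossing (R ++ bnd n c) →
  ∀ r E → NonCrossing E →
  (∀ e → e ∈ E → 0ℤ ≤ℤ zeta n c R r e) ⊎ (∀ e → e ∈ E → zeta n c R r e ≤ℤ 0ℤ)
zeta-sign-coherent {n} {c} {R} ordered noncrossing (u , v) E E-noncrossing
  with any? (λ e → zeta n c R (u , v) e ℤ.≟ -1ℤ) E
... | no no-negative = inj₁ nonnegative
  where
  nonnegative : ∀ e → e ∈ E → 0ℤ ≤ℤ zeta n c R (u , v) e
  nonnegative e e∈E with zeta-trichotomy ordered u v e
  ... | inj₁ (ζ≡-1 , _)        = ⊥-elim (no-negative (lose e∈E ζ≡-1))
  ... | inj₂ (inj₁ (ζ≡1 , _)) = subst (0ℤ ≤ℤ_) (sym ζ≡1) (+≤+ z≤n)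
  ... | inj₂ (inj₂ ζ≡0)       = ℤ.≤-reflexive (sym ζ≡0)
... | yes some-negative with find some-negative
...   | e₁ , e₁∈E , ζ₁≡-1 = inj₂ nonpositive
  where
  nonpositive : ∀ e → e ∈ E → zeta n c R (u , v) e ≤ℤ 0ℤ
  nonpositive e e∈E with zeta-trichotomy ordered u v e
  ... | inj₁ (ζ≡-1 , _)     = subst (_≤ℤ 0ℤ) (sym ζ≡-1) -≤+
  ... | inj₂ (inj₁ (_ , P)) = ⊥-elim (E-noncrossing e₁∈E e∈E
      (opposite-crossings-cross noncrossing (zeta-negative ordered ζ₁≡-1) P))
  ... | inj₂ (inj₂ ζ≡0)     = ℤ.≤-reflexive ζ≡0

negate-signs : ∀ {E : List Seg} {f : Seg → ℤ} →
  (∀ e → e ∈ E → 0ℤ ≤ℤ f e) ⊎ (∀ e → e ∈ E → f e ≤ℤ 0ℤ) →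
  (∀ e → e ∈ E → 0ℤ ≤ℤ - f e) ⊎ (∀ e → e ∈ E → - f e ≤ℤ 0ℤ)
negate-signs = swap ∘ Sum.map (λ h e e∈E → ℤ.neg-mono-≤ (h e e∈E))
                              (λ h e e∈E → ℤ.neg-mono-≤ (h e e∈E))

corollary2p9 : (n : ℕ) → 2 ≤ n → (D∘ D• : List Seg) →
    Dissection n hol D∘ → MaxAccDiss n D∘ D• →
    ((δ• : Seg) → δ• ∈ D• →
        ((δ∘ : Seg) → δ∘ ∈ D∘ → 0ℤ ≤ℤ cvec n D∘ D• δ• δ∘)
      ⊎ ((δ∘ : Seg) → δ∘ ∈ D∘ → cvec n D∘ D• δ• δ∘ ≤ℤ 0ℤ))
    ×
    ((δ∘ : Seg) → δ∘ ∈ D∘ →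
        ((δ• : Seg) → δ• ∈ D• → 0ℤ ≤ℤ gvec n D∘ δ• δ∘)
      ⊎ ((δ• : Seg) → δ• ∈ D• → gvec n D∘ δ• δ∘ ≤ℤ 0ℤ))
corollary2p9 (suc m) (s≤s 0<m) D∘ D• D∘-dissection ((D•-dissection , _) , _) =
    (λ δ• _ → negate-signs (coherent D•-dissection δ• D∘ (proj₂ D∘-dissection)))
  , (λ δ∘ _ → coherent D∘-dissection δ∘ D• (proj₂ D•-dissection))
  where
  coherent : ∀ {c R} → Dissection (suc m) c R → ∀ r E → NonCrossing E →
    (∀ e → e ∈ E → 0ℤ ≤ℤ zeta (suc m) c R r e) ⊎ (∀ e → e ∈ E → zeta (suc m) c R r e ≤ℤ 0ℤ)
  coherent dissection =
    zeta-sign-coherent (barred-ordered 0<m dissection) (barred-noncrossing 0<m dissection)
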